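{- Let $\varphi_p$ be a local specification (an LTL formula over $O_e\cup O_p$) for process $p$. There exists a nondeterministic Büchi automaton over the alphabet $2^{O_e\cup I_p}\times 2^{O_e\cup I_p}$, whose number of states is exponential in the length of $\varphi_p$, that accepts exactly those words $(\sigma_0,\sigma_0')(\sigma_1,\sigma_1')\ldots$ such that, writing $\sigma=\sigma_0\sigma_1\ldots$ and $\sigma'=\sigma_0'\sigma_1'\ldots$, if $(\sigma{\downarrow_{O_e}},\sigma'{\downarrow_{O_e}})\in\Delta_p$ then $\sigma{\downarrow_{I_p}}\neq\sigma'{\downarrow_{I_p}}$ (i.e. it recognizes the information flow assumption $\psi_p$).
   Context: $O_p$, $O_e$ and $I_p$ are finite sets of boolean variables with $O_p\cap O_e=\emptyset$ and $I_p\cap O_p=\emptyset$ ($O_p$: outputs of process $p$; $O_e$: environment outputs; $I_p$: inputs of $p$). Traces over $V$ are elements of $(2^V)^\omega$; $\sqcup$ is positionwise union of traces over disjoint sets and ${\downarrow_{V'}}$ is positionwise intersection with $V'$. The distinguishability relation is $\Delta_p=\{(\pi_e,\pi_e')\in(2^{O_e})^\omega\times(2^{O_e})^\omega\mid\forall\pi_p\in(2^{O_p})^\omega:\ \text{if }\pi_e\sqcup\pi_p\models\varphi_p\text{ then }\pi_e'\sqcup\pi_p\not\models\varphi_p\}$. -}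

module Defs where

open import Data.Nat using (ℕ; suc; _+_; _≤_; _<_)
open import Data.Fin using (Fin)
open import Data.Fin.Subset using (Subset; _∈_; _∉_; _⊆_; _∩_; _∪_)
open import Data.Product using (Σ; ∃; _×_; proj₁; proj₂)
open import Data.Empty using (⊥)
open import Data.Unit using (⊤)
open import Relation.Nullary using (¬_)
open import Relation.Binary.PropositionalEquality using (_≡_)

-- Boolean variables are the elements of Fin n; a set of variables is a Subset n.
-- Disjointness of two sets of variables.
Disjoint : ∀ {n} → Subset n → Subset n → Set
Disjoint A B = ∀ x → x ∈ A → x ∈ B → ⊥

Trace : ℕ → Set
Trace n = ℕ → Subset n

TraceOver : ∀ {n} → Subset n → Trace n → Set
TraceOver V π = ∀ i → π i ⊆ V

_⊔_ : ∀ {n} → Trace n → Trace n → Trace n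
(π ⊔ π') i = π i ∪ π' i

_↓_ : ∀ {n} → Trace n → Subset n → Trace n
(π ↓ V) i = π i ∩ V

data LTL (n : ℕ) : Set where
  tt   : LTL n
  atom : Fin n → LTL n
  ¬'_  : LTL n → LTL n
  _∧'_ : LTL n → LTL n → LTL n
  X'_  : LTL n → LTL n
  _U'_ : LTL n → LTL n → LTL n

size : ∀ {n} → LTL n → ℕ
size tt = 1
size (atom _) = 1
size (¬' φ) = suc (size φ)
size (φ ∧' ψ) = suc (size φ + size ψ)
size (X' φ) = suc (size φ)
size (φ U' ψ) = suc (size φ + size ψ)

AtomsIn : ∀ {n} → Subset n → LTL n → Set
AtomsIn V tt = ⊤
AtomsIn V (atom x) = x ∈ V
AtomsIn V (¬' φ) = AtomsIn V φ
AtomsIn V (φ ∧' ψ) = AtomsIn V φ × AtomsIn V ψ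
AtomsIn V (X' φ) = AtomsIn V φ
AtomsIn V (φ U' ψ) = AtomsIn V φ × AtomsIn V ψ

_,_⊨_ : ∀ {n} → Trace n → ℕ → LTL n → Set
π , i ⊨ tt = ⊤
π , i ⊨ atom x = x ∈ π i
π , i ⊨ (¬' φ) = ¬ (π , i ⊨ φ)
π , i ⊨ (φ ∧' ψ) = (π , i ⊨ φ) × (π , i ⊨ ψ)
π , i ⊨ (X' φ) = π , suc i ⊨ φ
π , i ⊨ (φ U' ψ) = ∃ λ k → (π , (k + i) ⊨ ψ) × (∀ j → j < k → π , (j + i) ⊨ φ)

_⊨_ : ∀ {n} → Trace n → LTL n → Set
π ⊨ φ = π , 0 ⊨ φ

Δ : ∀ {n} → (Op : Subset n) → LTL n → Trace n → Trace n → Set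
Δ {n} Op φ πe πe' = ∀ (πp : Trace n) → TraceOver Op πp →
  (πe ⊔ πp) ⊨ φ → ¬ ((πe' ⊔ πp) ⊨ φ)

Letter : ∀ {n} → Subset n → Set
Letter {n} V = Σ (Subset n) (λ s → s ⊆ V)

record NBA (A : Set) : Set₁ where
  field
    states    : ℕ
    initial   : Fin states → Set
    δ         : Fin states → A → Fin states → Set
    accepting : Fin states → Set

open NBA public

AcceptingRun : ∀ {A} → (𝒜 : NBA A) → (ℕ → A) → (ℕ → Fin (states 𝒜)) → Set
AcceptingRun 𝒜 w r =
  initial 𝒜 (r 0)
  × (∀ i → δ 𝒜 (r i) (w i) (r (suc i)))
  × (∀ i → ∃ λ j → i ≤ j × accepting 𝒜 (r j))

Accepts : ∀ {A} → NBA A → (ℕ → A) → Set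
Accepts 𝒜 w = ∃ λ r → AcceptingRun 𝒜 w r

InfoFlow : ∀ {n} → (Op Oe Ip : Subset n) → LTL n →
           (ℕ → Letter (Oe ∪ Ip) × Letter (Oe ∪ Ip)) → Set
InfoFlow Op Oe Ip φ w =
  Δ Op φ (σ ↓ Oe) (σ' ↓ Oe) → ¬ (∀ i → (σ ↓ Ip) i ≡ (σ' ↓ Ip) i)
  where
    σ  = λ i → proj₁ (proj₁ (w i))
    σ' = λ i → proj₁ (proj₂ (w i))

module Submission where

-- Classically ψ_p holds iff either some output trace π_p of p makes φ_p true together with both
-- σ↓O_e and σ'↓O_e (the pair is not in Δ_p), or σ and σ' differ on I_p at some position.  The
-- second language needs two states.  For the first, the automaton guesses π_p letter by letter
-- and runs two tableaux for φ_p side by side: a state guesses a truth value for every subformula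
-- in each copy (2^|φ_p| labels), transitions check Hintikka consistency, and one breakpoint set of
-- open until-promises per copy turns all eventualities into a single Büchi condition.  This gives
-- (2^|φ_p|)^4 + 2 ≤ 2^(5|φ_p|) states.

open import Defs
open import Axiom.ExcludedMiddle using (ExcludedMiddle)
open import Axiom.DoubleNegationElimination using (em⇒dne)
open import Level using (0ℓ)
open import Data.Bool using (Bool; true; false; not; _∧_; _∨_; T)
open import Data.Bool.Properties using (T-∧; T-∨)
open import Data.Empty using (⊥; ⊥-elim)
open import Data.Fin using (Fin)
open import Data.Fin.Properties using (1↔⊤; 2↔Bool; *↔×; +↔⊎)
open import Data.Fin.Subset using (Subset; _∪_; _∩_; _⊆_; _∈_)
open import Data.Nat
  using (ℕ; zero; suc; _+_; _*_; _^_; _≤_; _<_; _<?_; _≤′_; ≤′-refl; ≤′-step; z≤n; s≤s; s≤s⁻¹)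
  renaming (_⊔_ to _⊔ℕ_)
open import Data.Nat.Properties
open import Data.Product using (Σ; ∃; _×_; _,_; proj₁; proj₂)
open import Data.Product.Function.NonDependent.Propositional using (_×-⇔_; _×-↠_)
open import Data.Sum using (_⊎_; inj₁; inj₂)
open import Data.Sum.Function.Propositional using (_⊎-⇔_; _⊎-↠_)
open import Data.Unit using (⊤)
open import Function using (_∘_; _↠_; _⇔_; mk⇔; Equivalence; Surjection)
open import Function.Construct.Composition using (_↠-∘_)
open import Function.Properties.Equivalence using ()
  renaming (refl to ⇔-refl; trans to ⇔-trans; sym to ⇔-sym)
open import Function.Properties.Inverse using (↔⇒↠)
open import Function.Related.TypeIsomorphisms using (¬-cong-⇔)
open import Relation.Nullary using (¬_; Dec; does; yes; no)
open import Relation.Nullary.Decidable using (isYes; fromWitness; T?)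
open import Relation.Binary.PropositionalEquality
  using (_≡_; refl; sym; trans; cong; subst; subst₂)

open Equivalence using (to; from)

T-does : ∀ {P : Set} (d : Dec P) → T (does d) ⇔ P
T-does (yes p) = mk⇔ (λ _ → p) _
T-does (no ¬p) = mk⇔ (λ ()) ¬p

T-not : ∀ {b} → T (not b) ⇔ (¬ T b)
T-not {false} = mk⇔ (λ _ ()) _
T-not {true}  = mk⇔ (λ ()) (λ ¬t → ¬t _)

module Classical (em : ExcludedMiddle 0ℓ) where

  decide : Set → Bool
  decide P = does (em {P})

  T-decide : ∀ {P} → T (decide P) ⇔ P
  T-decide = T-does em

InfinitelyOften : (ℕ → Set) → Set
InfinitelyOften P = ∀ i → ∃ λ j → i ≤ j × P j

EventuallyAlways : (ℕ → Set) → ℕ → Set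
EventuallyAlways P i = ∃ λ K → i ≤ K × (∀ m → K ≤ m → P m)

eventually-always-× : ∀ {P Q i} → EventuallyAlways P i → EventuallyAlways Q i →
                      EventuallyAlways (λ m → P m × Q m) i
eventually-always-× (K , i≤K , p) (L , _ , q) =
  K ⊔ℕ L , ≤-trans i≤K (m≤m⊔n K L) ,
  λ m K⊔L≤m → p m (≤-trans (m≤m⊔n K L) K⊔L≤m) , q m (≤-trans (m≤n⊔m K L) K⊔L≤m)

stable-from : (P : ℕ → Set) {K : ℕ} → P K → (∀ k → K ≤ k → P k → P (suc k)) →
              ∀ {m} → K ≤ m → P m
stable-from P {K} p step = go ∘ ≤⇒≤′
  where
  go : ∀ {m} → K ≤′ m → P m
  go ≤′-refl       = p
  go (≤′-step K≤m) = step _ (≤′⇒≤ K≤m) (go K≤m)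

Fulfils : (ℕ → Bool) → (ℕ → Bool) → Set
Fulfils promise fulfilled = ∀ i → T (promise i) → ∃ λ j → i ≤ j × T (fulfilled j)

-- π , i ⊨ φ U' ψ is by definition Until (λ j → π , j ⊨ φ) (λ j → π , j ⊨ ψ) i.
Until : (ℕ → Set) → (ℕ → Set) → ℕ → Set
Until P Q i = ∃ λ k → Q (k + i) × (∀ j → j < k → P (j + i))

module _ {P Q : ℕ → Set} where

  until-now : ∀ {i} → Q i → Until P Q i
  until-now q = 0 , q , λ _ ()

  until-cons : ∀ {i} → P i → Until P Q (suc i) → Until P Q i
  until-cons {i} p (k , q , ps) = suc k , subst Q (+-suc k i) q , later
    where
    later : ∀ j → j < suc k → P (j + i)
    later zero    _         = p
    later (suc j) (s≤s j<k) = subst P (+-suc j i) (ps j j<k)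

  until-tail : ∀ {i k} → Q (suc k + i) → (∀ j → j < suc k → P (j + i)) → Until P Q (suc i)
  until-tail {i} {k} q ps =
    k , subst Q (sym (+-suc k i)) q , λ j j<k → subst P (sym (+-suc j i)) (ps (suc j) (s≤s j<k))

  until-expansion : ∀ {i} → Until P Q i ⇔ (Q i ⊎ (P i × Until P Q (suc i)))
  until-expansion = mk⇔ unfold fold
    where
    unfold : ∀ {i} → Until P Q i → Q i ⊎ (P i × Until P Q (suc i))
    unfold (zero  , q , _)  = inj₁ q
    unfold (suc k , q , ps) = inj₂ (ps 0 (s≤s z≤n) , until-tail q ps)
    fold : ∀ {i} → Q i ⊎ (P i × Until P Q (suc i)) → Until P Q i
    fold (inj₁ q)       = until-now q
    fold (inj₂ (p , u)) = until-cons p u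

  -- Until is the least solution of its expansion law, and a solution whose promises are all
  -- eventually kept is the least one.
  until-least : (b : ℕ → Bool) →
                (∀ i → T (b i) ⇔ (Q i ⊎ (P i × T (b (suc i))))) →
                (∀ i → T (b i) → ∃ λ j → i ≤ j × Q j) →
                ∀ i → T (b i) ⇔ Until P Q i
  until-least b expand fulfil i = mk⇔ complete (λ (k , q , ps) → sound k q ps)
    where
    sound : ∀ {i} k → Q (k + i) → (∀ j → j < k → P (j + i)) → T (b i)
    sound zero    q ps = from (expand _) (inj₁ q)
    sound (suc k) q ps = let (_ , q′ , ps′) = until-tail q ps in
      from (expand _) (inj₂ (ps 0 (s≤s z≤n) , sound k q′ ps′))
    reach : ∀ d {i} → T (b i) → Q (d + i) → Until P Q i
    reach zero    _  q = until-now q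
    reach (suc d) bᵢ q with to (expand _) bᵢ
    ... | inj₁ qᵢ       = until-now qᵢ
    ... | inj₂ (p , b′) = until-cons p (reach d b′ (subst Q (sym (+-suc d _)) q))
    complete : T (b i) → Until P Q i
    complete bᵢ with fulfil i bᵢ
    ... | j , i≤j , q with m≤n⇒∃[o]m+o≡n i≤j
    ... | d , refl = reach d bᵢ (subst Q (+-comm i d) q)

record Automaton (A S : Set) : Set₁ where
  field
    start : S → Set
    step  : S → A → S → Set
    final : S → Set

open Automaton

Accepting : ∀ {A S} → Automaton A S → (ℕ → A) → (ℕ → S) → Set
Accepting M w r =
  start M (r 0) × (∀ i → step M (r i) (w i) (r (suc i))) × InfinitelyOften (final M ∘ r)

_accepts_ : ∀ {A S} → Automaton A S → (ℕ → A) → Set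
M accepts w = ∃ (Accepting M w)

accepting-resp : ∀ {A S} (M : Automaton A S) {w r r′} →
                 (∀ i → r i ≡ r′ i) → Accepting M w r → Accepting M w r′
accepting-resp M {w} r≡r′ (s₀ , steps , fin) =
    subst (start M) (r≡r′ 0) s₀
  , (λ i → subst₂ (λ x y → step M x (w i) y) (r≡r′ i) (r≡r′ (suc i)) (steps i))
  , λ i → let (j , i≤j , f) = fin i in j , i≤j , subst (final M) (r≡r′ j) f

run-invariant : ∀ {A S} (M : Automaton A S) {w r} (P : S → Set) →
                (∀ {x a y} → P x → step M x a y → P y) →
                Accepting M w r → P (r 0) → ∀ i → P (r i)
run-invariant M P pres _                  p₀ zero    = p₀
run-invariant M P pres acc@(_ , steps , _) p₀ (suc i) =
  pres (run-invariant M P pres acc p₀ i) (steps i)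

finite-× : ∀ {k l} {A B : Set} → Fin k ↠ A → Fin l ↠ B → Fin (k * l) ↠ (A × B)
finite-× f g = (f ×-↠ g) ↠-∘ ↔⇒↠ *↔×

finite-⊎ : ∀ {k l} {A B : Set} → Fin k ↠ A → Fin l ↠ B → Fin (k + l) ↠ (A ⊎ B)
finite-⊎ f g = (f ⊎-↠ g) ↠-∘ ↔⇒↠ +↔⊎

toNBA : ∀ {A S k} → Fin k ↠ S → Automaton A S → NBA A
toNBA {k = k} f M = record
  { states    = k
  ; initial   = start M ∘ to′
  ; δ         = λ q a q′ → step M (to′ q) a (to′ q′)
  ; accepting = final M ∘ to′
  } where to′ = Surjection.to f

accepts-toNBA : ∀ {A S k} (f : Fin k ↠ S) (M : Automaton A S) w →
                Accepts (toNBA f M) w ⇔ M accepts w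
accepts-toNBA f M w = mk⇔
  (λ (r , acc) → Surjection.to f ∘ r , acc)
  (λ (r , acc) → Surjection.to⁻ f ∘ r
               , accepting-resp M (λ i → sym (Surjection.to∘to⁻ f (r i))) acc)

_∪ᴬ_ : ∀ {A S S′} → Automaton A S → Automaton A S′ → Automaton A (S ⊎ S′)
M ∪ᴬ N = record { start = start′ ; step = step′ ; final = final′ }
  where
  start′ : _ ⊎ _ → Set
  start′ (inj₁ s) = start M s
  start′ (inj₂ s) = start N s
  step′ : _ ⊎ _ → _ → _ ⊎ _ → Set
  step′ (inj₁ s) a (inj₁ s′) = step M s a s′
  step′ (inj₂ s) a (inj₂ s′) = step N s a s′
  step′ _        _ _         = ⊥
  final′ : _ ⊎ _ → Set
  final′ (inj₁ s) = final M s
  final′ (inj₂ s) = final N s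

module _ {A S S′ : Set} (M : Automaton A S) (N : Automaton A S′) where

  private
    FromLeft FromRight : S ⊎ S′ → Set
    FromLeft  x = ∃ λ s → x ≡ inj₁ s
    FromRight x = ∃ λ s → x ≡ inj₂ s

    side : ∀ x → FromLeft x ⊎ FromRight x
    side (inj₁ s) = inj₁ (s , refl)
    side (inj₂ s) = inj₂ (s , refl)

    stays-left : ∀ {x a y} → FromLeft x → step (M ∪ᴬ N) x a y → FromLeft y
    stays-left {y = inj₁ s} _ _ = s , refl
    stays-left {y = inj₂ _} (_ , refl) ()

    stays-right : ∀ {x a y} → FromRight x → step (M ∪ᴬ N) x a y → FromRight y
    stays-right {y = inj₂ s} _ _ = s , refl
    stays-right {y = inj₁ _} (_ , refl) ()

  accepts-∪ᴬ : ∀ w → (M ∪ᴬ N) accepts w ⇔ (M accepts w ⊎ N accepts w)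
  accepts-∪ᴬ w = mk⇔ split join
    where
    split : (M ∪ᴬ N) accepts w → M accepts w ⊎ N accepts w
    split (r , acc) with side (r 0)
    ... | inj₁ l₀ = inj₁ (proj₁ ∘ left , accepting-resp (M ∪ᴬ N) (proj₂ ∘ left) acc)
      where
      left : ∀ i → FromLeft (r i)
      left = run-invariant (M ∪ᴬ N) FromLeft stays-left acc l₀
    ... | inj₂ r₀ = inj₂ (proj₁ ∘ right , accepting-resp (M ∪ᴬ N) (proj₂ ∘ right) acc)
      where
      right : ∀ i → FromRight (r i)
      right = run-invariant (M ∪ᴬ N) FromRight stays-right acc r₀
    join : M accepts w ⊎ N accepts w → (M ∪ᴬ N) accepts w
    join (inj₁ (r , acc)) = inj₁ ∘ r , acc
    join (inj₂ (r , acc)) = inj₂ ∘ r , acc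

eventually : ∀ {A} → (A → Set) → Automaton A Bool
eventually {A} D = record { start = T ∘ not ; step = step′ ; final = T }
  where
  step′ : Bool → A → Bool → Set
  step′ false a false = ⊤
  step′ false a true  = D a
  step′ true  a true  = ⊤
  step′ true  a false = ⊥

module _ {A : Set} (D : A → Set) where

  private
    switch : ∀ {x a y} → T (not x) → T y → step (eventually D) x a y → D a
    switch {false} {_} {true} _ _ d = d

  accepts-eventually : ∀ w → eventually D accepts w ⇔ ∃ (D ∘ w)
  accepts-eventually w = mk⇔
    (λ (r , r₀ , steps , fin) → witness r r₀ steps (proj₂ (proj₂ (fin 0))))
    -- isYes rather than does: does (i <? k) reduces to i <ᵇ k, which would block the with below.
    (λ (i , d) → (λ k → isYes (i <? k)) , _ , steps i d , fin i)
    where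
    witness : ∀ r → T (not (r 0)) → (∀ i → step (eventually D) (r i) (w i) (r (suc i))) →
              ∀ {j} → T (r j) → ∃ (D ∘ w)
    witness r r₀ steps {zero} rⱼ = ⊥-elim (to T-not r₀ rⱼ)
    witness r r₀ steps {suc j} rⱼ with r j in eq
    ... | true  = witness r r₀ steps (subst T (sym eq) _)
    ... | false = j , switch (subst (T ∘ not) (sym eq) _) rⱼ (steps j)
    steps : ∀ i → D (w i) → ∀ k →
            step (eventually D) (isYes (i <? k)) (w k) (isYes (i <? suc k))
    steps i d k with i <? k | i <? suc k
    ... | yes _   | yes _     = _
    ... | no _    | no _      = _
    ... | yes i<k | no i≮1+k  = i≮1+k (m<n⇒m<1+n i<k)
    ... | no i≮k  | yes i<1+k = subst (D ∘ w) (≤-antisym (s≤s⁻¹ i<1+k) (≮⇒≥ i≮k)) d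
    fin : ∀ i j → ∃ λ k → j ≤ k × T (isYes (i <? k))
    fin i j = suc (i + j) , ≤-trans (m≤n+m j i) (n≤1+n _) , fromWitness (s≤s (m≤m+n i j))

-- One node of the breakpoint construction: o is the promise still owed since the last reset R,
-- p says whether a promise is open now.
renew : Bool → Bool → Bool → Bool
renew reset owed pending = pending ∧ (reset ∨ owed)

module Breakpoint {p o R : ℕ → Bool}
                  (renewal : ∀ k → o (suc k) ≡ renew (R k) (o k) (p (suc k))) where

  pending-not-forever : (∀ k → T (R k) → ¬ T (o k)) → InfinitelyOften (T ∘ R) →
                        ∀ i → ¬ (∀ k → i ≤ k → T (p k))
  -- A reset at j₀ leaves the open promise owed from then on, so the next reset sees o true.
  pending-not-forever cleared resets i always with resets i
  ... | j₀ , i≤j₀ , Rj₀ with resets (suc j₀)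
  ... | j₁ , j₀<j₁ , Rj₁ = cleared j₁ Rj₁ (owed j₀<j₁)
    where
    carried : ∀ k → i ≤ k → T (R k ∨ o k) → T (o (suc k))
    carried k i≤k r∨o =
      subst T (sym (renewal k)) (from T-∧ (always (suc k) (m≤n⇒m≤1+n i≤k) , r∨o))
    owed : ∀ {m} → suc j₀ ≤ m → T (o m)
    owed = stable-from (T ∘ o) (carried j₀ i≤j₀ (from T-∨ (inj₁ Rj₀)))
             (λ k j₀<k oₖ → carried k (≤-trans i≤j₀ (<⇒≤ j₀<k)) (from T-∨ (inj₂ oₖ)))

  eventually-clear : ∀ {i} → (∀ k → i ≤ k → ¬ T (R k)) →
                     InfinitelyOften (λ k → ¬ T (p k)) → EventuallyAlways (λ k → ¬ T (o k)) i
  eventually-clear {i} quiet lapses with lapses (suc i)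
  ... | suc j , s≤s i≤j , ¬pⱼ₊₁ =
    suc j , m≤n⇒m≤1+n i≤j , λ _ → stable-from (λ k → ¬ T (o k)) cleared₀ keep
    where
    cleared₀ : ¬ T (o (suc j))
    cleared₀ oⱼ₊₁ = ¬pⱼ₊₁ (proj₁ (to T-∧ (subst T (renewal j) oⱼ₊₁)))
    keep : ∀ k → suc j ≤ k → ¬ T (o k) → ¬ T (o (suc k))
    keep k j<k ¬oₖ oₖ₊₁ with to T-∨ (proj₂ (to T-∧ (subst T (renewal k) oₖ₊₁)))
    ... | inj₁ rₖ = quiet k (≤-trans i≤j (<⇒≤ j<k)) rₖ
    ... | inj₂ oₖ = ¬oₖ oₖ

fulfils-of-renewal : ExcludedMiddle 0ℓ → ∀ {b f o R : ℕ → Bool} →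
                     (∀ k → T (b k) → ¬ T (f k) → T (b (suc k))) →
                     (∀ k → o (suc k) ≡ renew (R k) (o k) (b (suc k) ∧ not (f (suc k)))) →
                     (∀ k → T (R k) → ¬ T (o k)) → InfinitelyOften (T ∘ R) → Fulfils b f
fulfils-of-renewal em {b} {f} persist renewal cleared resets i bᵢ = em⇒dne em λ never →
  let unfulfilled : ∀ k → i ≤ k → ¬ T (f k)
      unfulfilled k i≤k fₖ = never (k , i≤k , fₖ)
      promised : ∀ {k} → i ≤ k → T (b k)
      promised = stable-from (T ∘ b) bᵢ (λ k i≤k bₖ → persist k bₖ (unfulfilled k i≤k))
  in Breakpoint.pending-not-forever renewal cleared resets i
       (λ k i≤k → from T-∧ (promised i≤k , from T-not (unfulfilled k i≤k)))

fulfilled-idle : ∀ {b f : ℕ → Bool} → Fulfils b f →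
                 InfinitelyOften (λ k → ¬ T (b k ∧ not (f k)))
fulfilled-idle {b} {f} fulfil k with T? (b k)
... | no ¬bₖ = k , ≤-refl , ¬bₖ ∘ proj₁ ∘ to T-∧
... | yes bₖ = let (j , k≤j , fⱼ) = fulfil k bₖ in
  j , k≤j , λ pⱼ → to T-not (proj₂ (to T-∧ pⱼ)) fⱼ

never-pending : InfinitelyOften (λ _ → ¬ T false)
never-pending k = k , ≤-refl , λ ()

module Tableau {n : ℕ} where

  -- A label guesses, at one position, the truth value of every subformula of φ.
  mutual
    Label : LTL n → Set
    Label φ = Bool × Children φ

    Children : LTL n → Set
    Children tt       = ⊤
    Children (atom _) = ⊤
    Children (¬' φ)   = Label φ
    Children (φ ∧' ψ) = Label φ × Label ψ
    Children (X' φ)   = Label φ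
    Children (φ U' ψ) = Label φ × Label ψ

  root : ∀ {A : Set} → Bool × A → Bool
  root = proj₁

  left : ∀ {A B : Set} → Bool × (A × B) → A
  left = proj₁ ∘ proj₂

  right : ∀ {A B : Set} → Bool × (A × B) → B
  right = proj₂ ∘ proj₂

  mutual
    labels : ∀ φ → Fin (2 ^ size φ) ↠ Label φ
    labels tt       = finite-× (↔⇒↠ 2↔Bool) (↔⇒↠ 1↔⊤)
    labels (atom _) = finite-× (↔⇒↠ 2↔Bool) (↔⇒↠ 1↔⊤)
    labels (¬' φ)   = finite-× (↔⇒↠ 2↔Bool) (labels φ)
    labels (φ ∧' ψ) = finite-× (↔⇒↠ 2↔Bool) (labelPairs φ ψ)
    labels (X' φ)   = finite-× (↔⇒↠ 2↔Bool) (labels φ)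
    labels (φ U' ψ) = finite-× (↔⇒↠ 2↔Bool) (labelPairs φ ψ)

    labelPairs : ∀ φ ψ → Fin (2 ^ (size φ + size ψ)) ↠ (Label φ × Label ψ)
    labelPairs φ ψ = subst (λ k → Fin k ↠ (Label φ × Label ψ))
                           (sym (^-distribˡ-+-* 2 (size φ) (size ψ)))
                           (finite-× (labels φ) (labels ψ))

  Hintikka : ∀ φ → Label φ → Label φ → Subset n → Set
  Hintikka tt       (b , _)     _              a = T b
  Hintikka (atom x) (b , _)     _              a = T b ⇔ x ∈ a
  Hintikka (¬' φ)   (b , s)     (_  , s′)      a = (T b ⇔ (¬ T (root s))) × Hintikka φ s s′ a
  Hintikka (φ ∧' ψ) (b , s , t) (_  , s′ , t′) a =
    (T b ⇔ (T (root s) × T (root t))) × Hintikka φ s s′ a × Hintikka ψ t t′ a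
  Hintikka (X' φ)   (b , s)     (_  , s′)      a = (T b ⇔ T (root s′)) × Hintikka φ s s′ a
  Hintikka (φ U' ψ) (b , s , t) (b′ , s′ , t′) a =
    (T b ⇔ (T (root t) ⊎ (T (root s) × T b′))) × Hintikka φ s s′ a × Hintikka ψ t t′ a

  Consistent : ∀ φ → Trace n → (ℕ → Label φ) → Set
  Consistent φ π Ψ = ∀ i → Hintikka φ (Ψ i) (Ψ (suc i)) (π i)

  Fair : ∀ φ → (ℕ → Label φ) → Set
  Fair tt       _ = ⊤
  Fair (atom _) _ = ⊤
  Fair (¬' φ)   Ψ = Fair φ (proj₂ ∘ Ψ)
  Fair (φ ∧' ψ) Ψ = Fair φ (left ∘ Ψ) × Fair ψ (right ∘ Ψ)
  Fair (X' φ)   Ψ = Fair φ (proj₂ ∘ Ψ)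
  Fair (φ U' ψ) Ψ =
    Fulfils (root ∘ Ψ) (root ∘ right ∘ Ψ) × Fair φ (left ∘ Ψ) × Fair ψ (right ∘ Ψ)

  truth : ∀ φ {π Ψ} → Consistent φ π Ψ → Fair φ Ψ →
          ∀ i → T (root (Ψ i)) ⇔ _,_⊨_ π i φ
  truth tt       h _ i = mk⇔ _ (λ _ → h i)
  truth (atom x) h _ i = h i
  truth (¬' φ)   h f i = ⇔-trans (proj₁ (h i)) (¬-cong-⇔ (truth φ (proj₂ ∘ h) f i))
  truth (φ ∧' ψ) h (f , g) i =
    ⇔-trans (proj₁ (h i))
            (truth φ (proj₁ ∘ proj₂ ∘ h) f i ×-⇔ truth ψ (proj₂ ∘ proj₂ ∘ h) g i)
  truth (X' φ)   h f i = ⇔-trans (proj₁ (h i)) (truth φ (proj₂ ∘ h) f (suc i))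
  truth (φ U' ψ) {π} {Ψ} h (fulfil , f , g) =
    until-least (root ∘ Ψ)
      (λ i → ⇔-trans (proj₁ (h i)) (tψ i ⊎-⇔ (tφ i ×-⇔ ⇔-refl)))
      (λ i bᵢ → let (j , i≤j , fⱼ) = fulfil i bᵢ in j , i≤j , to (tψ j) fⱼ)
    where
    tφ : ∀ i → T (root (left (Ψ i))) ⇔ _,_⊨_ π i φ
    tφ = truth φ (proj₁ ∘ proj₂ ∘ h) f
    tψ : ∀ i → T (root (right (Ψ i))) ⇔ _,_⊨_ π i ψ
    tψ = truth ψ (proj₂ ∘ proj₂ ∘ h) g

  mutual
    tabulate : (LTL n → Bool) → ∀ φ → Label φ
    tabulate f φ = f φ , tabulateChildren f φ

    tabulateChildren : (LTL n → Bool) → ∀ φ → Children φ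
    tabulateChildren f tt       = _
    tabulateChildren f (atom _) = _
    tabulateChildren f (¬' φ)   = tabulate f φ
    tabulateChildren f (φ ∧' ψ) = tabulate f φ , tabulate f ψ
    tabulateChildren f (X' φ)   = tabulate f φ
    tabulateChildren f (φ U' ψ) = tabulate f φ , tabulate f ψ

  module Canonical (em : ExcludedMiddle 0ℓ) where
    open Classical em

    canonical : ∀ φ → Trace n → ℕ → Label φ
    canonical φ π i = tabulate (λ χ → decide (_,_⊨_ π i χ)) φ

    canonical-consistent : ∀ φ π → Consistent φ π (canonical φ π)
    canonical-consistent tt       π i = from T-decide _
    canonical-consistent (atom x) π i = T-decide
    canonical-consistent (¬' φ)   π i =
      ⇔-trans T-decide (¬-cong-⇔ (⇔-sym T-decide)) , canonical-consistent φ π i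
    canonical-consistent (φ ∧' ψ) π i =
      ⇔-trans T-decide (⇔-sym T-decide ×-⇔ ⇔-sym T-decide)
      , canonical-consistent φ π i , canonical-consistent ψ π i
    canonical-consistent (X' φ)   π i =
      ⇔-trans T-decide (⇔-sym T-decide) , canonical-consistent φ π i
    canonical-consistent (φ U' ψ) π i =
        ⇔-trans T-decide
          (⇔-trans expand (⇔-sym T-decide ⊎-⇔ (⇔-sym T-decide ×-⇔ ⇔-sym T-decide)))
      , canonical-consistent φ π i , canonical-consistent ψ π i
      where expand = until-expansion {λ j → _,_⊨_ π j φ} {λ j → _,_⊨_ π j ψ}

    canonical-fair : ∀ φ π → Fair φ (canonical φ π)
    canonical-fair tt       π = _
    canonical-fair (atom _) π = _
    canonical-fair (¬' φ)   π = canonical-fair φ π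
    canonical-fair (φ ∧' ψ) π = canonical-fair φ π , canonical-fair ψ π
    canonical-fair (X' φ)   π = canonical-fair φ π
    canonical-fair (φ U' ψ) π = fulfil , canonical-fair φ π , canonical-fair ψ π
      where
      fulfil : Fulfils (root ∘ canonical (φ U' ψ) π) (root ∘ canonical ψ π)
      fulfil i u = let (k , q , _) = to T-decide u in k + i , m≤n+m i k , from T-decide q

  pending : ∀ φ → Label φ → Label φ
  pending tt       (_ , _)     = false , _
  pending (atom _) (_ , _)     = false , _
  pending (¬' φ)   (_ , s)     = false , pending φ s
  pending (φ ∧' ψ) (_ , s , t) = false , pending φ s , pending ψ t
  pending (X' φ)   (_ , s)     = false , pending φ s
  pending (φ U' ψ) (b , s , t) = b ∧ not (root t) , pending φ s , pending ψ t

  carry : ∀ φ → Bool → Label φ → Label φ → Label φ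
  carry tt       r (o , _)     (p , _)       = renew r o p , _
  carry (atom _) r (o , _)     (p , _)       = renew r o p , _
  carry (¬' φ)   r (o , s)     (p , s′)      = renew r o p , carry φ r s s′
  carry (φ ∧' ψ) r (o , s , t) (p , s′ , t′) = renew r o p , carry φ r s s′ , carry ψ r t t′
  carry (X' φ)   r (o , s)     (p , s′)      = renew r o p , carry φ r s s′
  carry (φ U' ψ) r (o , s , t) (p , s′ , t′) = renew r o p , carry φ r s s′ , carry ψ r t t′

  Cleared : ∀ φ → Label φ → Set
  Cleared tt       (o , _)     = ¬ T o
  Cleared (atom _) (o , _)     = ¬ T o
  Cleared (¬' φ)   (o , s)     = ¬ T o × Cleared φ s
  Cleared (φ ∧' ψ) (o , s , t) = ¬ T o × Cleared φ s × Cleared ψ t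
  Cleared (X' φ)   (o , s)     = ¬ T o × Cleared φ s
  Cleared (φ U' ψ) (o , s , t) = ¬ T o × Cleared φ s × Cleared ψ t

  Renewed : ∀ φ → (ℕ → Label φ) → (ℕ → Bool) → (ℕ → Label φ) → Set
  Renewed φ Ψ R O = ∀ k → O (suc k) ≡ carry φ (R k) (O k) (pending φ (Ψ (suc k)))

  module _ (em : ExcludedMiddle 0ℓ) where

    fair-of-renewal : ∀ φ {π Ψ R O} → Consistent φ π Ψ → Renewed φ Ψ R O →
                      (∀ k → T (R k) → Cleared φ (O k)) → InfinitelyOften (T ∘ R) →
                      Fair φ Ψ
    fair-of-renewal tt       _ _ _ _ = _
    fair-of-renewal (atom _) _ _ _ _ = _
    fair-of-renewal (¬' φ)   h ren cl resets =
      fair-of-renewal φ (proj₂ ∘ h) (cong proj₂ ∘ ren) (λ k → proj₂ ∘ cl k) resets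
    fair-of-renewal (φ ∧' ψ) h ren cl resets =
        fair-of-renewal φ (proj₁ ∘ proj₂ ∘ h) (cong left ∘ ren) (λ k → proj₁ ∘ proj₂ ∘ cl k)
                        resets
      , fair-of-renewal ψ (proj₂ ∘ proj₂ ∘ h) (cong right ∘ ren) (λ k → proj₂ ∘ proj₂ ∘ cl k)
                        resets
    fair-of-renewal (X' φ)   h ren cl resets =
      fair-of-renewal φ (proj₂ ∘ h) (cong proj₂ ∘ ren) (λ k → proj₂ ∘ cl k) resets
    fair-of-renewal (φ U' ψ) {Ψ = Ψ} h ren cl resets =
        fulfils-of-renewal em persist (cong root ∘ ren) (λ k → proj₁ ∘ cl k) resets
      , fair-of-renewal φ (proj₁ ∘ proj₂ ∘ h) (cong left ∘ ren) (λ k → proj₁ ∘ proj₂ ∘ cl k)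
                        resets
      , fair-of-renewal ψ (proj₂ ∘ proj₂ ∘ h) (cong right ∘ ren) (λ k → proj₂ ∘ proj₂ ∘ cl k)
                        resets
      where
      persist : ∀ k → T (root (Ψ k)) → ¬ T (root (right (Ψ k))) → T (root (Ψ (suc k)))
      persist k bₖ ¬fₖ with to (proj₁ (h k)) bₖ
      ... | inj₁ fₖ       = ⊥-elim (¬fₖ fₖ)
      ... | inj₂ (_ , b′) = b′

  eventually-cleared : ∀ φ {Ψ R O i} → Fair φ Ψ → Renewed φ Ψ R O →
                       (∀ k → i ≤ k → ¬ T (R k)) → EventuallyAlways (Cleared φ ∘ O) i
  eventually-cleared tt       _ ren quiet = Breakpoint.eventually-clear (cong root ∘ ren) quiet never-pending
  eventually-cleared (atom _) _ ren quiet = Breakpoint.eventually-clear (cong root ∘ ren) quiet never-pending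
  eventually-cleared (¬' φ)   f ren quiet = eventually-always-×
    (Breakpoint.eventually-clear (cong root ∘ ren) quiet never-pending)
    (eventually-cleared φ f (cong proj₂ ∘ ren) quiet)
  eventually-cleared (φ ∧' ψ) (f , g) ren quiet = eventually-always-×
    (Breakpoint.eventually-clear (cong root ∘ ren) quiet never-pending)
    (eventually-always-× (eventually-cleared φ f (cong left ∘ ren) quiet)
                         (eventually-cleared ψ g (cong right ∘ ren) quiet))
  eventually-cleared (X' φ)   f ren quiet = eventually-always-×
    (Breakpoint.eventually-clear (cong root ∘ ren) quiet never-pending)
    (eventually-cleared φ f (cong proj₂ ∘ ren) quiet)
  eventually-cleared (φ U' ψ) (fulfil , f , g) ren quiet = eventually-always-×
    (Breakpoint.eventually-clear (cong root ∘ ren) quiet (fulfilled-idle fulfil))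
    (eventually-always-× (eventually-cleared φ f (cong left ∘ ren) quiet)
                         (eventually-cleared ψ g (cong right ∘ ren) quiet))

module Joint (em : ExcludedMiddle 0ℓ) {n : ℕ} (Op Oe : Subset n) (φ : LTL n) {V : Subset n}
  where
  open Tableau {n}
  open Canonical em
  open Classical em

  Pair : Set
  Pair = Letter V × Letter V

  first second : (ℕ → Pair) → Trace n
  first  w i = proj₁ (proj₁ (w i))
  second w i = proj₁ (proj₂ (w i))

  CoSatisfiable : (ℕ → Pair) → Set
  CoSatisfiable w =
    ∃ λ πp → TraceOver Op πp × (((first w ↓ Oe) ⊔ πp) ⊨ φ) × (((second w ↓ Oe) ⊔ πp) ⊨ φ)

  State : Set
  State = Label φ × Label φ × Label φ × Label φ

  reset : Label φ → Label φ → Bool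
  reset O₁ O₂ = decide (Cleared φ O₁ × Cleared φ O₂)

  joint : Automaton Pair State
  joint = record
    { start = λ (Ψ₁ , Ψ₂ , _) → T (root Ψ₁) × T (root Ψ₂)
    ; step  = λ (Ψ₁ , Ψ₂ , O₁ , O₂) ((σ , _) , (σ′ , _)) (Ψ₁′ , Ψ₂′ , O₁′ , O₂′) →
        ∃ λ p → p ⊆ Op
              × Hintikka φ Ψ₁ Ψ₁′ ((σ ∩ Oe) ∪ p) × Hintikka φ Ψ₂ Ψ₂′ ((σ′ ∩ Oe) ∪ p)
              × O₁′ ≡ carry φ (reset O₁ O₂) O₁ (pending φ Ψ₁′)
              × O₂′ ≡ carry φ (reset O₁ O₂) O₂ (pending φ Ψ₂′)
    ; final = λ (_ , _ , O₁ , O₂) → T (reset O₁ O₂)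
    }

  accepts-joint : ∀ w → joint accepts w ⇔ CoSatisfiable w
  accepts-joint w = mk⇔ sound complete
    where
    sound : joint accepts w → CoSatisfiable w
    sound (r , (s₁ , s₂) , steps , resets) = πp , over , sat₁ , sat₂
      where
      πp : Trace n
      πp k = let (p , _) = steps k in p
      over : TraceOver Op πp
      over k = let (_ , p⊆Op , _) = steps k in p⊆Op
      R : ℕ → Bool
      R k = let (_ , _ , O₁ , O₂) = r k in reset O₁ O₂
      consistent₁ : Consistent φ ((first w ↓ Oe) ⊔ πp) (proj₁ ∘ r)
      consistent₁ k = let (_ , _ , h₁ , _) = steps k in h₁
      consistent₂ : Consistent φ ((second w ↓ Oe) ⊔ πp) (proj₁ ∘ proj₂ ∘ r)
      consistent₂ k = let (_ , _ , _ , h₂ , _) = steps k in h₂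
      renewed₁ : Renewed φ (proj₁ ∘ r) R (proj₁ ∘ proj₂ ∘ proj₂ ∘ r)
      renewed₁ k = let (_ , _ , _ , _ , e₁ , _) = steps k in e₁
      renewed₂ : Renewed φ (proj₁ ∘ proj₂ ∘ r) R (proj₂ ∘ proj₂ ∘ proj₂ ∘ r)
      renewed₂ k = let (_ , _ , _ , _ , _ , e₂) = steps k in e₂
      sat₁ : ((first w ↓ Oe) ⊔ πp) ⊨ φ
      sat₁ = to (truth φ consistent₁ fair₁ 0) s₁
        where
        fair₁ : Fair φ (proj₁ ∘ r)
        fair₁ = fair-of-renewal em φ consistent₁ renewed₁ (λ _ → proj₁ ∘ to T-decide) resets
      sat₂ : ((second w ↓ Oe) ⊔ πp) ⊨ φ
      sat₂ = to (truth φ consistent₂ fair₂ 0) s₂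
        where
        fair₂ : Fair φ (proj₁ ∘ proj₂ ∘ r)
        fair₂ = fair-of-renewal em φ consistent₂ renewed₂ (λ _ → proj₂ ∘ to T-decide) resets
    complete : CoSatisfiable w → joint accepts w
    complete (πp , over , sat₁ , sat₂) =
      run , (from T-decide sat₁ , from T-decide sat₂) , steps , resets
      where
      π₁ π₂ : Trace n
      π₁ = (first w ↓ Oe) ⊔ πp
      π₂ = (second w ↓ Oe) ⊔ πp
      obligations : ℕ → Label φ × Label φ
      obligations zero    = pending φ (canonical φ π₁ 0) , pending φ (canonical φ π₂ 0)
      obligations (suc k) = let (O₁ , O₂) = obligations k in
        carry φ (reset O₁ O₂) O₁ (pending φ (canonical φ π₁ (suc k))) ,
        carry φ (reset O₁ O₂) O₂ (pending φ (canonical φ π₂ (suc k)))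
      run : ℕ → State
      run k = canonical φ π₁ k , canonical φ π₂ k , obligations k
      steps : ∀ k → step joint (run k) (w k) (run (suc k))
      steps k =
        πp k , over k , canonical-consistent φ π₁ k , canonical-consistent φ π₂ k , refl , refl
      resets : InfinitelyOften (final joint ∘ run)
      resets i = em⇒dne em λ none →
        let quiet : ∀ k → i ≤ k → ¬ final joint (run k)
            quiet k i≤k Rₖ = none (k , i≤k , Rₖ)
            (K , i≤K , cleared) = eventually-always-×
              (eventually-cleared φ {O = proj₁ ∘ obligations} (canonical-fair φ π₁) (λ _ → refl) quiet)
              (eventually-cleared φ {O = proj₂ ∘ obligations} (canonical-fair φ π₂) (λ _ → refl) quiet)
        in quiet K i≤K (from T-decide (cleared K ≤-refl))

Differ : ∀ {n} → Subset n → {V : Subset n} → Letter V × Letter V → Set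
Differ Ip ((σ , _) , (σ′ , _)) = ¬ (σ ∩ Ip ≡ σ′ ∩ Ip)

module _ (em : ExcludedMiddle 0ℓ) {n : ℕ} (Op Oe Ip : Subset n) (φ : LTL n) where
  open Joint em Op Oe φ {Oe ∪ Ip}

  infoFlow⇔ : ∀ w → InfoFlow Op Oe Ip φ w ⇔ (CoSatisfiable w ⊎ ∃ (Differ Ip ∘ w))
  infoFlow⇔ w = mk⇔ split join
    where
    split : InfoFlow Op Oe Ip φ w → CoSatisfiable w ⊎ ∃ (Differ Ip ∘ w)
    split assumption with em {CoSatisfiable w}
    ... | yes co = inj₁ co
    ... | no ¬co = inj₂ (em⇒dne em λ same →
      assumption (λ πp over sat₁ sat₂ → ¬co (πp , over , sat₁ , sat₂))
                 (λ i → em⇒dne em λ differ → same (i , differ)))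
    join : CoSatisfiable w ⊎ ∃ (Differ Ip ∘ w) → InfoFlow Op Oe Ip φ w
    join (inj₁ (πp , over , sat₁ , sat₂)) Δp _    = Δp πp over sat₁ sat₂
    join (inj₂ (i , differ))              _  same = differ (same i)

  flowAutomaton : Automaton Pair (State ⊎ Bool)
  flowAutomaton = joint ∪ᴬ eventually (Differ Ip)

  accepts-flowAutomaton : ∀ w → flowAutomaton accepts w ⇔ InfoFlow Op Oe Ip φ w
  accepts-flowAutomaton w =
    ⇔-trans (accepts-∪ᴬ joint (eventually (Differ Ip)) w)
   (⇔-trans (accepts-joint w ⊎-⇔ accepts-eventually (Differ Ip) w)
            (⇔-sym (infoFlow⇔ w)))

  flowAutomaton-states : Fin (2 ^ size φ * (2 ^ size φ * (2 ^ size φ * 2 ^ size φ)) + 2)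
                         ↠ (State ⊎ Bool)
  flowAutomaton-states = finite-⊎ (finite-× Lφ (finite-× Lφ (finite-× Lφ Lφ))) (↔⇒↠ 2↔Bool)
    where
    Lφ : Fin (2 ^ size φ) ↠ Tableau.Label φ
    Lφ = Tableau.labels φ

quartic+2≤quintic : ∀ {X} → 2 ≤ X → X * (X * (X * X)) + 2 ≤ X ^ 5
quartic+2≤quintic {X} 2≤X@(s≤s (s≤s _)) = begin
  Q + 2      ≤⟨ +-monoʳ-≤ Q 2≤Q ⟩
  Q + Q      ≡⟨ cong (Q +_) (sym (+-identityʳ Q)) ⟩
  2 * Q      ≤⟨ *-monoˡ-≤ Q 2≤X ⟩
  X * Q      ≡⟨ cong (λ y → X * (X * (X * (X * y)))) (sym (*-identityʳ X)) ⟩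
  X ^ 5      ∎
  where
  open ≤-Reasoning
  Q : ℕ
  Q = X * (X * (X * X))
  2≤Q : 2 ≤ Q
  2≤Q = ≤-trans 2≤X (m≤m*n X (X * (X * X)))

2≤2^size : ∀ {n} (φ : LTL n) → 2 ≤ 2 ^ size φ
2≤2^size φ = ^-monoʳ-≤ 2 (1≤size φ)
  where
  1≤size : ∀ φ → 1 ≤ size φ
  1≤size tt       = s≤s z≤n
  1≤size (atom _) = s≤s z≤n
  1≤size (¬' _)   = s≤s z≤n
  1≤size (_ ∧' _) = s≤s z≤n
  1≤size (X' _)   = s≤s z≤n
  1≤size (_ U' _) = s≤s z≤n

flowAutomaton-bound : ∀ {n} (φ : LTL n) →
  2 ^ size φ * (2 ^ size φ * (2 ^ size φ * 2 ^ size φ)) + 2 ≤ 2 ^ (5 * size φ)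
flowAutomaton-bound φ =
  ≤-trans (quartic+2≤quintic (2≤2^size φ))
          (≤-reflexive (trans (^-*-assoc 2 (size φ) 5) (cong (2 ^_) (*-comm (size φ) 5))))

theorem3 : ExcludedMiddle 0ℓ →
    ∃ λ (c : ℕ) → ∀ {n} (Op Oe Ip : Subset n) →
      Disjoint Op Oe → Disjoint Ip Op →
      (φ : LTL n) → AtomsIn (Oe ∪ Op) φ →
      Σ (NBA (Letter (Oe ∪ Ip) × Letter (Oe ∪ Ip))) λ 𝒜 →
        states 𝒜 ≤ 2 ^ (c * size φ)
        × (∀ w → Accepts 𝒜 w ⇔ InfoFlow Op Oe Ip φ w)
theorem3 em = 5 , λ Op Oe Ip _ _ φ _ →
  let enumeration = flowAutomaton-states em Op Oe Ip φ
      M           = flowAutomaton em Op Oe Ip φ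
  in  toNBA enumeration M
    , flowAutomaton-bound φ
    , λ w → ⇔-trans (accepts-toNBA enumeration M w) (accepts-flowAutomaton em Op Oe Ip φ w)
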